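{- Let $\ell\ge4$ be an integer, $f$ a slow function, $G$ the $(f,\ell)$-layered wheel with layers $L_1,L_2,\dots$, $X\subseteq V(G)$ a finite set and $k\ge1$ an integer with $\omega(G[X])\le k$. If $v\in L_i$ and $f(i+1)\ge k+2$, then there exists at least one child $u$ of $v$ such that the arc $vu$ is augmenting with respect to $X$.
   Context: A child of $v\in L_i$ is a neighbour of $v$ in $L_{i+1}$ (each vertex of $L_{i+1}$ has at most one neighbour in $L_i$). For a child $u$ of $v$, the arc $vu$ is augmenting with respect to $X$ if $N^\uparrow(u)\cap X=N^\uparrow[v]\cap X$. $\omega$ denotes the clique number. A function $f:\mathbb N\setminus\{0\}\to\mathbb N\setminus\{0\}$ is slow if $f(1)=1,f(2)=2,f(3)=3$ and $f(i)\le f(i+1)\le f(i)+1$ for all $i$. The $(f,\ell)$-layered wheel $G$ is the infinite graph (considered as an undirected simple graph; orientations only descriptive) whose vertex set is partitioned into finite layers $L_1,L_2,\dots$, built inductively. For $v\in L_i$ let $N^\uparrow(v)$ be the set of neighbours of $v$ in $L_1\cup\dots\cup L_{i-1}$ and $N^\uparrow[v]=N^\uparrow(v)\cup\{v\}$. $L_1$ induces a directed cycle of length $\ell$. Given $L_1,\dots,L_i$, for each $v\in L_i$ create a directed path $L(v)=v_1\dots v_{n_v}$ of new vertices: (a) if $|N^\uparrow(v)|<f(i+1)-1$, then $n_v=\ell-2$, $N^\uparrow(v_1)=N^\uparrow[v]$ and $N^\uparrow(v_j)=\emptyset$ for $j\ge2$; (b) if $|N^\uparrow(v)|=f(i+1)-1=:m$,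 write $N^\uparrow(v)=\{w_1,\dots,w_m\}$; then $n_v=m(\ell-2)$, $N^\uparrow(v_{(j-1)(\ell-2)+1})=N^\uparrow[v]\setminus\{w_j\}$ for $j=1,\dots,m$, and all other vertices of $L(v)$ have $N^\uparrow=\emptyset$ (the construction guarantees $|N^\uparrow(v)|\le f(i)-1\le f(i+1)-1$ always). Specifying $N^\uparrow(u)$ for a new vertex $u$ means $u$ is adjacent exactly to those vertices of earlier layers. $L_{i+1}=\bigcup_{v\in L_i}V(L(v))$ induces the directed cycle obtained from the paths $L(v)$ by adding, for every arc $vv'$ of the cycle $L_i$, the arc $v_{n_v}v'_1$. -}

module Defs where

open import Data.Nat using (ℕ; zero; suc; _+_; _*_; _∸_; _≤_; _<_; _<ᵇ_)
open import Data.Nat.DivMod using (_/_; _%_)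
open import Data.Bool using (Bool; true; false; if_then_else_)
open import Data.Maybe using (Maybe; just; nothing)
open import Data.List using (List; []; _∷_; length)
open import Data.List.Membership.Propositional using (_∈_)
open import Data.List.Relation.Unary.Unique.Propositional using (Unique)
open import Data.Product using (_×_)
open import Data.Sum using (_⊎_)
open import Data.Empty using (⊥)
open import Relation.Binary.PropositionalEquality using (_≡_; _≢_)

Slow : (ℕ → ℕ) → Set
Slow f = f 1 ≡ 1 × f 2 ≡ 2 × f 3 ≡ 3
       × (∀ i → 1 ≤ i → f i ≤ f (suc i) × f (suc i) ≤ suc (f i))

removeAt : {A : Set} → ℕ → List A → List A
removeAt q [] = []
removeAt zero (x ∷ xs) = xs
removeAt (suc q) (x ∷ xs) = x ∷ removeAt q xs

blockOf : ℕ → ℕ → Maybe ℕ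
blockOf zero j = nothing
blockOf (suc d) j with j % suc d
... | zero = just (j / suc d)
... | suc _ = nothing

-- Vertices are encoded as lists of naturals (most recent index first):
--   a ∷ []        is the a-th vertex (0-based) of the cycle L₁ (a < ℓ);
--   j ∷ v         is the vertex v_{j+1} of the path L(v) (0-based index j).
-- The layer of a vertex v is  length v.
-- 'ord v U' is the (arbitrary) enumeration w₁,…,w_m of N↑(v) = U used in case (b).
module LW (ℓ : ℕ) (f : ℕ → ℕ) (ord : List ℕ → List (List ℕ) → List (List ℕ)) where

  -- case (a) applies to v (in layer i = length v, with N↑(v) = U) iff |U| < f(i+1) - 1
  caseA : List ℕ → List (List ℕ) → Bool
  caseA v U = suc (length U) <ᵇ f (suc (length v))

  -- N↑ of the child with index j of v, given U = N↑(v)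
  childUp : List ℕ → List (List ℕ) → ℕ → List (List ℕ)
  childUp v U j with caseA v U
  ... | true with j
  ...   | zero = v ∷ U
  ...   | suc _ = []
  childUp v U j | false with blockOf (ℓ ∸ 2) j
  ...   | just q = v ∷ removeAt q (ord v U)       -- N↑[v] ∖ {w_{q+1}}
  ...   | nothing = []

  -- N↑(v): neighbours of v in earlier layers
  upN : List ℕ → List (List ℕ)
  upN [] = []
  upN (a ∷ []) = []
  upN (j ∷ v@(_ ∷ _)) = childUp v (upN v) j

  nChildren : List ℕ → ℕ
  nChildren v = if caseA v (upN v) then ℓ ∸ 2 else length (upN v) * (ℓ ∸ 2)

  Valid : List ℕ → Set
  Valid [] = ⊥
  Valid (a ∷ []) = a < ℓ
  Valid (j ∷ v@(_ ∷ _)) = Valid v × j < nChildren v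

  -- successor of a vertex on the directed cycle of its layer
  next : List ℕ → List ℕ
  next [] = []
  next (a ∷ []) = if suc a <ᵇ ℓ then suc a ∷ [] else 0 ∷ []
  next (j ∷ v@(_ ∷ _)) = if suc j <ᵇ nChildren v then suc j ∷ v else 0 ∷ next v

  Adj : List ℕ → List ℕ → Set
  Adj x y = Valid x × Valid y × (x ∈ upN y ⊎ y ∈ upN x ⊎ next x ≡ y ⊎ next y ≡ x)

  IsClique : List (List ℕ) → Set
  IsClique C = Unique C × (∀ x y → x ∈ C → y ∈ C → x ≢ y → Adj x y)

  CliqueNumberAtMost : List (List ℕ) → ℕ → Set
  CliqueNumberAtMost X k = ∀ C → (∀ x → x ∈ C → x ∈ X) → IsClique C → length C ≤ k

  Child : List ℕ → List ℕ → Set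
  Child v u = Adj v u × length u ≡ suc (length v)

  Augmenting : List (List ℕ) → List ℕ → List ℕ → Set
  Augmenting X v u = ∀ w → w ∈ X →
    (w ∈ upN u → w ∈ v ∷ upN v) × (w ∈ v ∷ upN v → w ∈ upN u)

-- By induction on the layer, N↑(v) is a clique: N↑ of a child of v is contained in N↑[v].
-- In case (a) the first child of v sees exactly N↑[v], so that arc is augmenting. In case (b),
-- N↑(v) is a clique of size f(i+1) - 1 ≥ k + 1, so as ω(G[X]) ≤ k some wⱼ ∈ N↑(v) lies outside X;
-- the child of v seeing N↑[v] ∖ {wⱼ} then sees the same part of X as v does.
module Submission where

open import Defs
open import Data.Nat using (ℕ; zero; suc; _+_; _*_; _∸_; _≤_; _<_; s≤s; s≤s⁻¹; z≤n; NonZero; >-nonZero; >-nonZero⁻¹)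
open import Data.Nat.Properties using (_≟_; ≮⇒≥; <⇒<ᵇ; <⇒≱; ≤-trans; +-comm; *-monoˡ-<; n<1+n; m<n⇒m<1+n; <-irrefl; ∸-monoˡ-≤)
open import Data.Nat.DivMod using (m*n%n≡0; m*n/n≡m)
open import Data.Bool using (true; false; T)
open import Data.Maybe using (just; nothing)
open import Data.List using (List; []; _∷_; length)
open import Data.List.Properties using (≡-dec)
open import Data.List.Membership.Propositional using (_∈_; _∉_)
open import Data.List.Relation.Unary.Any using (here; there)
open import Data.List.Relation.Unary.All using (All)
open import Data.List.Relation.Unary.All.Properties using (anti-mono; ¬Any⇒All¬)
open import Data.List.Relation.Unary.AllPairs using (AllPairs; []; _∷_)
open import Data.List.Relation.Unary.Unique.Propositional using (Unique)
open import Data.List.Relation.Binary.Subset.Propositional using (_⊆_)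
open import Data.List.Relation.Binary.Subset.Propositional.Properties using (∷⁺ʳ)
open import Data.List.Relation.Binary.Permutation.Propositional using (_↭_; ↭-sym; ↭⇒↭ₛ)
open import Data.List.Relation.Binary.Permutation.Propositional.Properties using (∈-resp-↭; ↭-length)
import Data.List.Relation.Binary.Permutation.Setoid.Properties as ↭ₛ
open import Data.Product using (_×_; _,_; ∃; proj₁; proj₂)
open import Data.Sum using (_⊎_; inj₁; inj₂)
open import Data.Empty using (⊥-elim)
open import Relation.Nullary using (yes; no; ¬_)
open import Relation.Binary.Definitions using (DecidableEquality)
open import Relation.Binary.PropositionalEquality using (_≡_; _≢_; refl; sym; subst; setoid)

module _ {A : Set} where

  removeAt-⊆ : ∀ q (xs : List A) → removeAt q xs ⊆ xs
  removeAt-⊆ q       []       ()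
  removeAt-⊆ zero    (x ∷ xs) m         = there m
  removeAt-⊆ (suc q) (x ∷ xs) (here e)  = here e
  removeAt-⊆ (suc q) (x ∷ xs) (there m) = there (removeAt-⊆ q xs m)

  AllPairs-removeAt : ∀ {R : A → A → Set} q {xs} → AllPairs R xs → AllPairs R (removeAt q xs)
  AllPairs-removeAt q       []         = []
  AllPairs-removeAt zero    (_ ∷ rxs)  = rxs
  AllPairs-removeAt (suc q) (px ∷ rxs) = anti-mono (removeAt-⊆ q _) px ∷ AllPairs-removeAt q rxs

  Unique-resp-↭ : ∀ {xs ys : List A} → xs ↭ ys → Unique xs → Unique ys
  Unique-resp-↭ σ = ↭ₛ.Unique-resp-↭ (setoid A) (↭⇒↭ₛ σ)

  Dispensable : List A → List A → ℕ → Set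
  Dispensable X xs q = q < length xs × (∀ {w} → w ∈ X → w ∈ xs → w ∈ removeAt q xs)

  module _ (_≟ᴬ_ : DecidableEquality A) where
    open import Data.List.Membership.DecPropositional _≟ᴬ_ using (_∈?_)

    ⊆⊎dispensable : ∀ X xs → xs ⊆ X ⊎ ∃ (Dispensable X xs)
    ⊆⊎dispensable X [] = inj₁ λ ()
    ⊆⊎dispensable X (x ∷ xs) with x ∈? X
    ... | no x∉X = inj₂ (0 , s≤s z≤n , keep)
      where
      keep : ∀ {w} → w ∈ X → w ∈ x ∷ xs → w ∈ xs
      keep w∈X (here refl) = ⊥-elim (x∉X w∈X)
      keep w∈X (there m)   = m
    ... | yes x∈X with ⊆⊎dispensable X xs
    ...   | inj₁ xs⊆X = inj₁ λ { (here refl) → x∈X ; (there m) → xs⊆X m }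
    ...   | inj₂ (q , q< , keep) = inj₂ (suc q , s≤s q< , keep′)
      where
      keep′ : ∀ {w} → w ∈ X → w ∈ x ∷ xs → w ∈ x ∷ removeAt q xs
      keep′ w∈X (here e)  = here e
      keep′ w∈X (there m) = there (keep w∈X m)

blockOf-* : ∀ q d .{{_ : NonZero d}} → blockOf d (q * d) ≡ just q
blockOf-* q d@(suc _) rewrite m*n%n≡0 q d ⦃ _ ⦄ | m*n/n≡m q d ⦃ _ ⦄ = refl

module Wheel (ℓ : ℕ) (f : ℕ → ℕ) (ord : List ℕ → List (List ℕ) → List (List ℕ))
             (ord↭ : ∀ v xs → ord v xs ↭ xs) where
  open LW ℓ f ord

  removeAt-ord-⊆ : ∀ q v U → removeAt q (ord v U) ⊆ U
  removeAt-ord-⊆ q v U m = ∈-resp-↭ (ord↭ v U) (removeAt-⊆ q (ord v U) m)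

  childUp-caseA : ∀ v U → caseA v U ≡ true → childUp v U 0 ≡ v ∷ U
  childUp-caseA v U eq with caseA v U
  childUp-caseA v U refl | true = refl

  childUp-caseB : ∀ v U j q → caseA v U ≡ false → blockOf (ℓ ∸ 2) j ≡ just q
                → childUp v U j ≡ v ∷ removeAt q (ord v U)
  childUp-caseB v U j q eq b with caseA v U
  childUp-caseB v U j q refl b | false with blockOf (ℓ ∸ 2) j
  childUp-caseB v U j q refl refl | false | just .q = refl

  caseA-false : ∀ v U → caseA v U ≡ false → f (suc (length v)) ≤ suc (length U)
  caseA-false v U eq = ≮⇒≥ λ lt → subst T eq (<⇒<ᵇ lt)

  childUp-shape : ∀ v U j → childUp v U j ≡ [] ⊎ childUp v U j ≡ v ∷ U
                          ⊎ ∃ λ q → childUp v U j ≡ v ∷ removeAt q (ord v U)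
  childUp-shape v U j with caseA v U
  ... | true with j
  ...   | zero  = inj₂ (inj₁ refl)
  ...   | suc _ = inj₁ refl
  childUp-shape v U j | false with blockOf (ℓ ∸ 2) j
  ...   | just q   = inj₂ (inj₂ (q , refl))
  ...   | nothing  = inj₁ refl

  childUp-⊆ : ∀ v U j → childUp v U j ⊆ v ∷ U
  childUp-⊆ v U j with childUp-shape v U j
  ... | inj₁ eq              = subst (_⊆ v ∷ U) (sym eq) λ ()
  ... | inj₂ (inj₁ eq)       = subst (_⊆ v ∷ U) (sym eq) λ m → m
  ... | inj₂ (inj₂ (q , eq)) = subst (_⊆ v ∷ U) (sym eq) (∷⁺ʳ v (removeAt-ord-⊆ q v U))

  childUp-unique : ∀ v U j → Unique U → v ∉ U → Unique (childUp v U j)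
  childUp-unique v U j uniq v∉U with childUp-shape v U j
  ... | inj₁ eq              = subst Unique (sym eq) []
  ... | inj₂ (inj₁ eq)       = subst Unique (sym eq) (¬Any⇒All¬ U v∉U ∷ uniq)
  ... | inj₂ (inj₂ (q , eq)) = subst Unique (sym eq)
    (anti-mono (removeAt-ord-⊆ q v U) (¬Any⇒All¬ U v∉U)
       ∷ AllPairs-removeAt q (Unique-resp-↭ (↭-sym (ord↭ v U)) uniq))

  upN-earlier : ∀ {v} → Valid v → ∀ {w} → w ∈ upN v → Valid w × length w < length v
  upN-earlier {[]}            ()
  upN-earlier {a ∷ []}        _ ()
  upN-earlier {j ∷ v@(_ ∷ _)} (valid-v , _) w∈ =
    closedUpN-earlier (upN-earlier valid-v) (childUp-⊆ v (upN v) j w∈)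
    where
    closedUpN-earlier : (∀ {w} → w ∈ upN v → Valid w × length w < length v)
                      → ∀ {w} → w ∈ v ∷ upN v → Valid w × length w < suc (length v)
    closedUpN-earlier _  (here refl) = valid-v , n<1+n (length v)
    closedUpN-earlier ih (there w∈′) = proj₁ (ih w∈′) , m<n⇒m<1+n (proj₂ (ih w∈′))

  upN-irrefl : ∀ {v} → Valid v → v ∉ upN v
  upN-irrefl valid-v v∈ = <-irrefl refl (proj₂ (upN-earlier valid-v v∈))

  IsClique-⊆ : ∀ {C D} → IsClique C → D ⊆ C → Unique D → IsClique D
  IsClique-⊆ (_ , adj) D⊆C uniq-D = uniq-D , λ x y x∈ y∈ → adj x y (D⊆C x∈) (D⊆C y∈)

  upN-isClique : ∀ {v} → Valid v → IsClique (upN v)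
  closedUpN-isClique : ∀ {v} → Valid v → IsClique (v ∷ upN v)

  upN-isClique {[]}            ()
  upN-isClique {a ∷ []}        _ = [] , λ _ _ ()
  upN-isClique {j ∷ v@(_ ∷ _)} (valid-v , _) =
    IsClique-⊆ (closedUpN-isClique valid-v) (childUp-⊆ v (upN v) j)
      (childUp-unique v (upN v) j (proj₁ (upN-isClique valid-v)) (upN-irrefl valid-v))

  closedUpN-isClique {v} valid-v = ¬Any⇒All¬ (upN v) (upN-irrefl valid-v) ∷ uniq , adj′
    where
    uniq = proj₁ (upN-isClique valid-v)
    adj  = proj₂ (upN-isClique valid-v)
    adj′ : ∀ x y → x ∈ v ∷ upN v → y ∈ v ∷ upN v → x ≢ y → Adj x y
    adj′ x y (here refl) (here refl) x≢y = ⊥-elim (x≢y refl)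
    adj′ x y (here refl) (there y∈)  _   = valid-v , proj₁ (upN-earlier valid-v y∈) , inj₂ (inj₁ y∈)
    adj′ x y (there x∈)  (here refl) _   = proj₁ (upN-earlier valid-v x∈) , valid-v , inj₁ x∈
    adj′ x y (there x∈)  (there y∈)  x≢y = adj x y x∈ y∈ x≢y

  nChildren-caseA : ∀ v → caseA v (upN v) ≡ true → nChildren v ≡ ℓ ∸ 2
  nChildren-caseA v eq rewrite eq = refl

  nChildren-caseB : ∀ v → caseA v (upN v) ≡ false → nChildren v ≡ length (upN v) * (ℓ ∸ 2)
  nChildren-caseB v eq rewrite eq = refl

  child-∷ : ∀ {v j S} → Valid v → j < nChildren v → upN (j ∷ v) ≡ v ∷ S → Child v (j ∷ v)
  child-∷ {[]}    ()
  child-∷ {_ ∷ _} valid-v j<n eq =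
    (valid-v , (valid-v , j<n) , inj₁ (subst (_ ∈_) (sym eq) (here refl))) , refl

  augmenting-∷ : ∀ {X v u S} → upN u ≡ v ∷ S → S ⊆ upN v
               → (∀ {w} → w ∈ X → w ∈ upN v → w ∈ S) → Augmenting X v u
  augmenting-∷ {v = v} eq S⊆ keep w w∈X rewrite eq =
    ∷⁺ʳ v S⊆ , λ { (here e) → here e ; (there w∈) → there (keep w∈X w∈) }

  upN-⊈ : ∀ {X k v} → CliqueNumberAtMost X k → Valid v → caseA v (upN v) ≡ false
        → k + 2 ≤ f (suc (length v)) → ¬ (upN v ⊆ X)
  upN-⊈ {X} {k} {v} ω≤k valid-v eq k+2≤f upN⊆X =
    <⇒≱ upN-large (ω≤k (upN v) (λ _ → upN⊆X) (upN-isClique valid-v))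
    where
    upN-large : k < length (upN v)
    upN-large = s≤s⁻¹ (subst (_≤ suc (length (upN v))) (+-comm k 2)
                         (≤-trans k+2≤f (caseA-false v (upN v) eq)))

  augmenting-child : ∀ {X k v} .{{_ : NonZero (ℓ ∸ 2)}} → CliqueNumberAtMost X k → Valid v
                   → k + 2 ≤ f (suc (length v)) → ∃ λ u → Child v u × Augmenting X v u
  augmenting-child {v = []} _ ()
  augmenting-child {X} {v = v@(_ ∷ _)} ω≤k valid-v k+2≤f with caseA v (upN v) in eq
  ... | true =
    0 ∷ v , child-∷ valid-v 0<n eqU , augmenting-∷ eqU (λ m → m) (λ _ m → m)
    where
    eqU = childUp-caseA v (upN v) eq
    0<n = subst (0 <_) (sym (nChildren-caseA v eq)) (>-nonZero⁻¹ (ℓ ∸ 2))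
  ... | false with ⊆⊎dispensable (≡-dec _≟_) X (ord v (upN v))
  ...   | inj₁ ord⊆X =
    ⊥-elim (upN-⊈ ω≤k valid-v eq k+2≤f (λ m → ord⊆X (∈-resp-↭ (↭-sym (ord↭ v (upN v))) m)))
  ...   | inj₂ (q , q< , keep) =
    j ∷ v , child-∷ valid-v j<n eqU ,
    augmenting-∷ eqU (removeAt-ord-⊆ q v (upN v))
                 (λ w∈X w∈ → keep w∈X (∈-resp-↭ (↭-sym (ord↭ v (upN v))) w∈))
    where
    j = q * (ℓ ∸ 2)
    eqU = childUp-caseB v (upN v) j q eq (blockOf-* q (ℓ ∸ 2))
    j<n = subst (j <_) (sym (nChildren-caseB v eq))
            (*-monoˡ-< (ℓ ∸ 2) (subst (q <_) (↭-length (ord↭ v (upN v))) q<))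

mainTheorem11 : (ℓ : ℕ) (f : ℕ → ℕ) (ord : List ℕ → List (List ℕ) → List (List ℕ))
    → 4 ≤ ℓ → Slow f → (∀ v xs → ord v xs ↭ xs)
    → (X : List (List ℕ)) → All (LW.Valid ℓ f ord) X
    → (k : ℕ) → 1 ≤ k → LW.CliqueNumberAtMost ℓ f ord X k
    → (i : ℕ) (v : List ℕ) → LW.Valid ℓ f ord v → length v ≡ i
    → k + 2 ≤ f (suc i)
    → ∃ λ u → LW.Child ℓ f ord v u × LW.Augmenting ℓ f ord X v u
mainTheorem11 ℓ f ord 4≤ℓ _ ord↭ _ _ _ _ ω≤k _ v valid-v refl k+2≤f =
  Wheel.augmenting-child ℓ f ord ord↭ ⦃ >-nonZero (≤-trans (s≤s z≤n) (∸-monoˡ-≤ 2 4≤ℓ)) ⦄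
    ω≤k valid-v k+2≤f
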